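{- Let $\varphi(x)$ be an $\mathcal{L}_{rings}$-formula in one free variable, and let $R$ be a commutative unital ring satisfying the axioms $\mathcal{A}_{\varphi}$ (described in the context) with distinguished ideal $\mathcal{F}in\subseteq\mathbb{B}$. Suppose $R$ satisfies condition $(\sharp)$: for every $e\in\mathcal{F}in$ there are $g,h\in R$ with $$[[e=1]]\leq [[gh=1 \wedge \varphi(g) \wedge \neg \varphi(h)]].$$ Then $\mathcal{F}in$ is definable: for every idempotent $e$ of $R$, $$e\in \mathcal{F}in \iff \exists g \,\exists h\ \big(e\leq [[gh=1 \wedge \varphi(g) \wedge \neg \varphi(h)]]\big).$$
   Context: All rings are commutative and unital with $0\neq 1$; $\mathcal{L}_{rings}=\{+,\cdot,0,1\}$. For a ring $R$, $\mathbb{B}$ is the Boolean algebra of idempotents with $e\wedge f=ef$, $\neg e=1-e$, $e\vee f=e+f-ef$, $0$, $1$, order $e\le f\iff ef=e$. An atom is a minimal nonzero element of $\mathbb{B}$. For an idempotent $e$, $R_e$ is the localization of $R$ at $\{e^n:n\ge0\}$ (isomorphic to $R/(1-e)R$), and $(f)_e$ the image of $f\in R$ in $R_e$. For an $\mathcal{L}_{rings}$-formula $\Theta(x_1,\dots,x_n)$ and $f_i\in R$, $[[\Theta(f_1,\dots,f_n)]]$ is the supremum in $\mathbb{B}$ of the atoms $e$ with $R_e\models\Theta((f_1)_e,\dots,(f_n)_e)$, when it exists. $T^{fin}$ is the theory, in the language $\{\vee,\wedge,\neg,0,1,Fin\}$ with $Fin$ a unary predicate, stating: the Boolean algebra is infinite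 and atomic; $Fin$ is a proper ideal; $\forall x(\neg Fin(x)\to\exists y(y<x\wedge\neg Fin(y)\wedge\neg Fin(x\wedge\neg y)))$; and for each $n<\omega$, every element with at most $n$ atoms below it lies in $Fin$. The axiom set $\mathcal{A}_\varphi$ consists of: (1) $\mathbb{B}$ is atomic; (2) $[[\Theta(f_1,\dots,f_n)]]$ exists in $\mathbb{B}$ for every $\mathcal{L}_{rings}$-formula $\Theta$ and all $f_i\in R$; (3) for every atomic $\mathcal{L}_{rings}$-formula $\Theta$, $R\models\Theta(f_1,\dots,f_n)$ iff $[[\Theta(f_1,\dots,f_n)]]=1$; ($4^{fin}$) $R$ is equipped with an ideal $\mathcal{F}in$ of $\mathbb{B}$ such that $(\mathbb{B},\mathcal{F}in)\models T^{fin}$, and for every $\mathcal{L}_{rings}$-formula $\Theta(x_1,\dots,x_n,w)$ and $f_1,\dots,f_n\in R$ there is $g\in R$ such that if $[[\exists w\,\Theta(\bar f,w)]]\wedge\neg[[\exists w\,(\varphi(w)\wedge\Theta(\bar f,w))]]\in\mathcal{F}in$ then $[[\exists w\,\Theta(\bar f,w)]]\wedge\neg[[\Theta(\bar f,g)]]\in\mathcal{F}in$; (5) for all $x\in R$, $[[\neg\varphi(x)]]\in\mathcal{F}in$. -}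

module Defs where

open import Level using (Level; _⊔_; Lift; lift)
open import Algebra.Bundles using (CommutativeRing)
open import Data.Nat using (ℕ; suc)
open import Data.Fin using (Fin; zero; suc)
open import Data.Product using (Σ; ∃; _×_; _,_)
open import Data.Sum using (_⊎_)
open import Relation.Nullary using (¬_)
open import Relation.Binary.PropositionalEquality using (_≡_)

data Term (n : ℕ) : Set where
  var  : Fin n → Term n
  `0 `1 : Term n
  _⊕_ _⊗_ : Term n → Term n → Term n

data Formula (n : ℕ) : Set where
  _≐_  : Term n → Term n → Formula n
  ~_   : Formula n → Formula n
  _∧'_ _∨'_ _⇒'_ : Formula n → Formula n → Formula n
  ∃' ∀' : Formula (suc n) → Formula n           -- binds variable  zero

renameT : ∀ {m n} → (Fin m → Fin n) → Term m → Term n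
renameT ρ (var i) = var (ρ i)
renameT ρ `0 = `0
renameT ρ `1 = `1
renameT ρ (s ⊕ t) = renameT ρ s ⊕ renameT ρ t
renameT ρ (s ⊗ t) = renameT ρ s ⊗ renameT ρ t

lift↑ : ∀ {m n} → (Fin m → Fin n) → Fin (suc m) → Fin (suc n)
lift↑ ρ zero = zero
lift↑ ρ (suc i) = suc (ρ i)

rename : ∀ {m n} → (Fin m → Fin n) → Formula m → Formula n
rename ρ (s ≐ t) = renameT ρ s ≐ renameT ρ t
rename ρ (~ φ) = ~ rename ρ φ
rename ρ (φ ∧' ψ) = rename ρ φ ∧' rename ρ ψ
rename ρ (φ ∨' ψ) = rename ρ φ ∨' rename ρ ψ
rename ρ (φ ⇒' ψ) = rename ρ φ ⇒' rename ρ ψ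
rename ρ (∃' φ) = ∃' (rename (lift↑ ρ) φ)
rename ρ (∀' φ) = ∀' (rename (lift↑ ρ) φ)

_at_ : ∀ {n} → Formula 1 → Fin n → Formula n
φ at i = rename (λ _ → i) φ

module _ {c ℓ : Level} (R : CommutativeRing c ℓ) where
  open CommutativeRing R hiding (zero)

  Env : ℕ → Set c
  Env n = Fin n → Carrier

  _∷ₑ_ : ∀ {n} → Carrier → Env n → Env (suc n)
  (a ∷ₑ ρ) zero = a
  (a ∷ₑ ρ) (suc i) = ρ i

  ⟦_⟧ : ∀ {n} → Term n → Env n → Carrier
  ⟦ var i ⟧ ρ = ρ i
  ⟦ `0 ⟧ ρ = 0#
  ⟦ `1 ⟧ ρ = 1#
  ⟦ s ⊕ t ⟧ ρ = ⟦ s ⟧ ρ + ⟦ t ⟧ ρ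
  ⟦ s ⊗ t ⟧ ρ = ⟦ s ⟧ ρ * ⟦ t ⟧ ρ

  -- R_e ⊨ Θ((f_1)_e, …, (f_n)_e).  R_e ≅ R/(1-e)R is represented with
  -- carrier R and equality  a ~ b  iff  e·a ≈ e·b  (i.e. a - b ∈ (1-e)R);
  -- quantifiers range over R, which surjects onto R_e.
  Sat : Carrier → ∀ {n} → Formula n → Env n → Set (c ⊔ ℓ)
  Sat e (s ≐ t) ρ = Lift c (e * ⟦ s ⟧ ρ ≈ e * ⟦ t ⟧ ρ)
  Sat e (~ φ) ρ = ¬ Sat e φ ρ
  Sat e (φ ∧' ψ) ρ = Sat e φ ρ × Sat e ψ ρ
  Sat e (φ ∨' ψ) ρ = Sat e φ ρ ⊎ Sat e ψ ρ
  Sat e (φ ⇒' ψ) ρ = Sat e φ ρ → Sat e ψ ρ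
  Sat e (∃' φ) ρ = Σ Carrier λ a → Sat e φ (a ∷ₑ ρ)
  Sat e (∀' φ) ρ = (a : Carrier) → Sat e φ (a ∷ₑ ρ)

  SatAtR : ∀ {n} → Term n → Term n → Env n → Set ℓ
  SatAtR s t ρ = ⟦ s ⟧ ρ ≈ ⟦ t ⟧ ρ

  Idem : Carrier → Set ℓ
  Idem e = e * e ≈ e

  _-'_ : Carrier → Carrier → Carrier
  x -' y = x + (- y)

  ¬B : Carrier → Carrier
  ¬B e = 1# -' e

  _∨B_ : Carrier → Carrier → Carrier
  e ∨B f = (e + f) -' (e * f)

  _≤B_ : Carrier → Carrier → Set ℓ
  e ≤B f = e * f ≈ e

  _<B_ : Carrier → Carrier → Set ℓ
  e <B f = e ≤B f × ¬ (e ≈ f)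

  Atom : Carrier → Set (c ⊔ ℓ)
  Atom a = Idem a × ¬ (a ≈ 0#) ×
           (∀ f → Idem f → f ≤B a → ¬ (f ≈ 0#) → f ≈ a)

  AtomicB : Set (c ⊔ ℓ)
  AtomicB = ∀ e → Idem e → ¬ (e ≈ 0#) → Σ Carrier λ a → Atom a × a ≤B e

  IsSup : (Carrier → Set (c ⊔ ℓ)) → Carrier → Set (c ⊔ ℓ)
  IsSup P b = Idem b × (∀ a → P a → a ≤B b)
              × (∀ u → Idem u → (∀ a → P a → a ≤B u) → b ≤B u)

  TV : ∀ {n} → Formula n → Env n → Carrier → Set (c ⊔ ℓ)
  TV Θ ρ = IsSup (λ a → Atom a × Sat a Θ ρ)

  InfiniteB : Set (c ⊔ ℓ)
  InfiniteB = ∀ (n : ℕ) → Σ (Fin n → Carrier) λ v →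
                (∀ i → Idem (v i)) × (∀ i j → v i ≈ v j → i ≡ j)

  IdealB : (Carrier → Set (c ⊔ ℓ)) → Set (c ⊔ ℓ)
  IdealB I = (∀ e → I e → Idem e) × I 0#
             × (∀ e f → Idem e → I f → e ≤B f → I e)
             × (∀ e f → I e → I f → I (e ∨B f))

  AtMostAtoms : ℕ → Carrier → Set (c ⊔ ℓ)
  AtMostAtoms n x = ∀ (v : Fin (suc n) → Carrier) → (∀ i → Atom (v i) × v i ≤B x)
                    → Σ (Fin (suc n)) λ i → Σ (Fin (suc n)) λ j → ¬ (i ≡ j) × v i ≈ v j

  Tfin : (Carrier → Set (c ⊔ ℓ)) → Set (c ⊔ ℓ)
  Tfin I = InfiniteB × AtomicB
           × (IdealB I × ¬ I 1#)
           × (∀ x → Idem x → ¬ I x →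
                Σ Carrier λ y → Idem y × y <B x × ¬ I y × ¬ I (x * ¬B y))
           × (∀ n x → Idem x → AtMostAtoms n x → I x)

  record Axioms (φ : Formula 1) (𝓕 : Carrier → Set (c ⊔ ℓ)) : Set (c ⊔ ℓ) where
    field
      ax1 : AtomicB
      ax2 : ∀ {n} (Θ : Formula n) (ρ : Env n) → Σ Carrier (TV Θ ρ)
      ax3 : ∀ {n} (s t : Term n) (ρ : Env n) (b : Carrier) → TV (s ≐ t) ρ b →
              (SatAtR s t ρ → b ≈ 1#) × (b ≈ 1# → SatAtR s t ρ)
      ax4-Tfin : Tfin 𝓕
      -- Θ(x̄, w): w is variable zero, x_i is variable suc i
      ax4 : ∀ {n} (Θ : Formula (suc n)) (ρ : Env n) → Σ Carrier λ g →
              ∀ b₁ b₂ b₃ → TV (∃' Θ) ρ b₁ → TV (∃' ((φ at zero) ∧' Θ)) ρ b₂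
                → TV Θ (g ∷ₑ ρ) b₃
                → 𝓕 (b₁ * ¬B b₂) → 𝓕 (b₁ * ¬B b₃)
      ax5 : ∀ x b → TV (~ φ) (x ∷ₑ (λ ())) b → 𝓕 b

  ψ♯ : Formula 1 → Formula 2
  ψ♯ φ = ((var zero ⊗ var (suc zero)) ≐ `1) ∧' ((φ at zero) ∧' (~ (φ at suc zero)))

  pair : Carrier → Carrier → Env 2
  pair g h = g ∷ₑ (h ∷ₑ (λ ()))

  isOne : Formula 1
  isOne = var zero ≐ `1

  Sharp : Formula 1 → (Carrier → Set (c ⊔ ℓ)) → Set (c ⊔ ℓ)
  Sharp φ 𝓕 = ∀ e → 𝓕 e → Σ Carrier λ g → Σ Carrier λ h →
                ∀ b₁ b₂ → TV isOne (e ∷ₑ (λ ())) b₁ → TV (ψ♯ φ) (pair g h) b₂ → b₁ ≤B b₂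

module Submission where

-- Write [[ψ]] for the truth value [[g·h = 1 ∧ φ(g) ∧ ¬φ(h)]] of the chosen
-- witnesses.  The two directions of the equivalence are independent.
--
--  (⇒) For e ∈ 𝓕in, (♯) gives g, h with [[e = 1]] ≤ [[ψ]].  Every idempotent
--      satisfies e ≤ [[e = 1]]: each atom a below e has a·e = a, i.e.
--      R_a ⊨ e = 1, and in an atomic Boolean algebra an element lies below
--      b as soon as every atom below it does (this needs excluded middle).
--  (⇐) If e ≤ [[ψ]], then e ≤ [[¬φ(h)]], since every atom satisfying ψ
--      satisfies ¬φ(h) (a renaming argument on formulas), and [[¬φ(h)]]
--      lies in 𝓕in by axiom (5); 𝓕in is downward closed.

open import Defs
open import Level using (Level; _⊔_; Lift; lift)
open import Algebra.Bundles using (CommutativeRing)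
open import Axiom.ExcludedMiddle using (ExcludedMiddle)
open import Data.Empty using (⊥-elim)
open import Data.Fin using (Fin; zero; suc)
open import Data.Product using (Σ; _×_; _,_; map₂)
open import Data.Product.Function.NonDependent.Propositional using (_×-⇔_)
open import Data.Sum.Function.Propositional using (_⊎-⇔_)
open import Function.Base using (id; _∘_)
open import Function.Bundles using (_⇔_; mk⇔; Equivalence)
open import Function.Construct.Composition using (_⇔-∘_)
open import Function.Construct.Symmetry using (⇔-sym)
open import Function.Related.TypeIsomorphisms using (→-cong-⇔; ¬-cong-⇔)
open import Relation.Nullary using (¬_; yes; no)
open import Relation.Binary.PropositionalEquality as ≡ using (_≡_)

module BooleanAlgebra {c ℓ : Level} (R : CommutativeRing c ℓ) where
  open CommutativeRing R hiding (zero)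
  open import Relation.Binary.Reasoning.Setoid setoid
  open import Algebra.Properties.Ring ring using (x[y-z]≈xy-xz; -0#≈0#)
  open import Algebra.Properties.Group +-group using (x∙y⁻¹≈ε⇒x≈y)
  open import Algebra.Properties.CommutativeSemigroup *-commutativeSemigroup
    using (interchange)

  ≤B-trans : ∀ {e f g} → _≤B_ R e f → _≤B_ R f g → _≤B_ R e g
  ≤B-trans {e} {f} {g} e≤f f≤g = begin
    e * g        ≈⟨ *-congʳ e≤f ⟨
    (e * f) * g  ≈⟨ *-assoc e f g ⟩
    e * (f * g)  ≈⟨ *-congˡ f≤g ⟩
    e * f        ≈⟨ e≤f ⟩
    e            ∎

  meet-≤ʳ : ∀ e {f} → Idem R f → _≤B_ R (e * f) f
  meet-≤ʳ e {f} f² = trans (*-assoc e f f) (*-congˡ f²)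

  meet-≤ˡ : ∀ {e} f → Idem R e → _≤B_ R (e * f) e
  meet-≤ˡ {e} f e² = begin
    (e * f) * e  ≈⟨ *-congʳ (*-comm e f) ⟩
    (f * e) * e  ≈⟨ meet-≤ʳ f e² ⟩
    f * e        ≈⟨ *-comm f e ⟩
    e * f        ∎

  idem-* : ∀ {e f} → Idem R e → Idem R f → Idem R (e * f)
  idem-* {e} {f} e² f² = trans (interchange e f e f) (*-cong e² f²)

  ·¬B-self : ∀ {b} → Idem R b → b * ¬B R b ≈ 0#
  ·¬B-self {b} b² = begin
    b * (1# - b)       ≈⟨ x[y-z]≈xy-xz b 1# b ⟩
    b * 1# - b * b     ≈⟨ +-cong (*-identityʳ b) (-‿cong b²) ⟩
    b - b              ≈⟨ -‿inverseʳ b ⟩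
    0#                 ∎

  idem-¬B : ∀ {b} → Idem R b → Idem R (¬B R b)
  idem-¬B {b} b² = begin
    n * (1# - b)       ≈⟨ x[y-z]≈xy-xz n 1# b ⟩
    n * 1# - n * b     ≈⟨ +-cong (*-identityʳ n) (-‿cong n·b≈0) ⟩
    n - 0#             ≈⟨ +-congˡ -0#≈0# ⟩
    n + 0#             ≈⟨ +-identityʳ n ⟩
    n                  ∎
    where
    n = ¬B R b
    n·b≈0 : n * b ≈ 0#
    n·b≈0 = trans (*-comm n b) (·¬B-self b²)

  below-b-and-¬b⇒0 : ∀ {a b} → _≤B_ R a b → _≤B_ R a (¬B R b) → a ≈ 0#
  below-b-and-¬b⇒0 {a} {b} a≤b a≤¬b = begin
    a                  ≈⟨ a≤¬b ⟨
    a * (1# - b)       ≈⟨ x[y-z]≈xy-xz a 1# b ⟩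
    a * 1# - a * b     ≈⟨ +-cong (*-identityʳ a) (-‿cong a≤b) ⟩
    a - a              ≈⟨ -‿inverseʳ a ⟩
    0#                 ∎

  ·¬B≈0⇒≤B : ∀ {e b} → e * ¬B R b ≈ 0# → _≤B_ R e b
  ·¬B≈0⇒≤B {e} {b} e·¬b≈0 = sym (x∙y⁻¹≈ε⇒x≈y e (e * b) (begin
    e - e * b          ≈⟨ +-congʳ (*-identityʳ e) ⟨
    e * 1# - e * b     ≈⟨ x[y-z]≈xy-xz e 1# b ⟨
    e * (1# - b)       ≈⟨ e·¬b≈0 ⟩
    0#                 ∎))

  -- In an atomic Boolean algebra, e ≤ b once every atom below e is below b.
  -- Classical: the proof decides whether e·¬b = 0.
  atoms-below⇒≤B : ExcludedMiddle (c ⊔ ℓ) → AtomicB R → ∀ {e b} → Idem R e → Idem R b →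
                   (∀ a → Atom R a → _≤B_ R a e → _≤B_ R a b) → _≤B_ R e b
  atoms-below⇒≤B em atomic {e} {b} e² b² atoms≤b with em {Lift c (e * ¬B R b ≈ 0#)}
  ... | yes (lift e·¬b≈0) = ·¬B≈0⇒≤B e·¬b≈0
  ... | no e·¬b≉0
    with atomic (e * ¬B R b) (idem-* e² (idem-¬B b²)) (λ e·¬b≈0 → e·¬b≉0 (lift e·¬b≈0))
  ...   | a , atom@(_ , a≉0 , _) , a≤e·¬b = ⊥-elim (a≉0 (below-b-and-¬b⇒0 a≤b a≤¬b))
    where
    a≤e   = ≤B-trans a≤e·¬b (meet-≤ˡ (¬B R b) e²)
    a≤¬b  = ≤B-trans a≤e·¬b (meet-≤ʳ e (idem-¬B b²))
    a≤b   = atoms≤b a atom a≤e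

  ideal-downward : ∀ {I : Carrier → Set (c ⊔ ℓ)} → Tfin R I →
                   ∀ {e f} → Idem R e → I f → _≤B_ R e f → I e
  ideal-downward (_ , _ , ((_ , _ , downward , _) , _) , _) = downward _ _

module Renaming {c ℓ : Level} (R : CommutativeRing c ℓ) where
  open CommutativeRing R using (_≈_; _+_; _*_)
  open Equivalence

  Agree : ∀ {m n} → (Fin m → Fin n) → Env R m → Env R n → Set c
  Agree r ρ ρ′ = ∀ i → ρ′ (r i) ≡ ρ i

  agree-lift : ∀ {m n} {r : Fin m → Fin n} {ρ ρ′} → Agree r ρ ρ′ →
               ∀ a → Agree (lift↑ r) (_∷ₑ_ R a ρ) (_∷ₑ_ R a ρ′)
  agree-lift ag a zero    = ≡.refl
  agree-lift ag a (suc i) = ag i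

  ⟦⟧-rename : ∀ {m n} {r : Fin m → Fin n} {ρ ρ′} → Agree r ρ ρ′ →
              ∀ t → ⟦_⟧ R (renameT r t) ρ′ ≡ ⟦_⟧ R t ρ
  ⟦⟧-rename ag (var i) = ag i
  ⟦⟧-rename ag `0      = ≡.refl
  ⟦⟧-rename ag `1      = ≡.refl
  ⟦⟧-rename ag (s ⊕ t) = ≡.cong₂ _+_ (⟦⟧-rename ag s) (⟦⟧-rename ag t)
  ⟦⟧-rename ag (s ⊗ t) = ≡.cong₂ _*_ (⟦⟧-rename ag s) (⟦⟧-rename ag t)

  Sat-rename : ∀ {m n} {r : Fin m → Fin n} {ρ ρ′} → Agree r ρ ρ′ →
               ∀ e (θ : Formula m) → Sat R e (rename r θ) ρ′ ⇔ Sat R e θ ρ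
  Sat-rename {r = r} {ρ} {ρ′} ag e (s ≐ t) =
    mk⇔ (≡.subst id same-atom) (≡.subst id (≡.sym same-atom))
    where
    same-atom : Sat R e (rename r (s ≐ t)) ρ′ ≡ Sat R e (s ≐ t) ρ
    same-atom = ≡.cong₂ (λ x y → Lift c (e * x ≈ e * y)) (⟦⟧-rename ag s) (⟦⟧-rename ag t)
  Sat-rename ag e (~ θ)    = ¬-cong-⇔ (Sat-rename ag e θ)
  Sat-rename ag e (θ ∧' χ) = Sat-rename ag e θ ×-⇔ Sat-rename ag e χ
  Sat-rename ag e (θ ∨' χ) = Sat-rename ag e θ ⊎-⇔ Sat-rename ag e χ
  Sat-rename ag e (θ ⇒' χ) = →-cong-⇔ (Sat-rename ag e θ) (Sat-rename ag e χ)
  Sat-rename {r = r} {ρ} {ρ′} ag e (∃' θ) = mk⇔ (map₂ (to (under _))) (map₂ (from (under _)))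
    where
    under : ∀ a → Sat R e (rename (lift↑ r) θ) (_∷ₑ_ R a ρ′) ⇔ Sat R e θ (_∷ₑ_ R a ρ)
    under a = Sat-rename (agree-lift ag a) e θ
  Sat-rename {r = r} {ρ} {ρ′} ag e (∀' θ) =
    mk⇔ (λ s a → to (under a) (s a)) (λ s a → from (under a) (s a))
    where
    under : ∀ a → Sat R e (rename (lift↑ r) θ) (_∷ₑ_ R a ρ′) ⇔ Sat R e θ (_∷ₑ_ R a ρ)
    under a = Sat-rename (agree-lift ag a) e θ

  Sat-at : ∀ {n} (φ : Formula 1) (i : Fin n) (ρ : Env R n) (ρ₀ : Env R 0) e →
           Sat R e (φ at i) ρ ⇔ Sat R e φ (_∷ₑ_ R (ρ i) ρ₀)
  Sat-at φ i ρ ρ₀ e = Sat-rename agree e φ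
    where
    agree : Agree (λ _ → i) (_∷ₑ_ R (ρ i) ρ₀) ρ
    agree zero = ≡.refl

  emptyEnv : Env R 0
  emptyEnv ()

  Sat-env-irrelevant : (φ : Formula 1) → ∀ e {x} {ρ₀ ρ₁ : Env R 0} →
                       Sat R e φ (_∷ₑ_ R x ρ₀) ⇔ Sat R e φ (_∷ₑ_ R x ρ₁)
  Sat-env-irrelevant φ e {x} {ρ₀} {ρ₁} =
    Sat-at φ zero (_∷ₑ_ R x ρ₀) ρ₁ e ⇔-∘ ⇔-sym (Sat-at φ zero (_∷ₑ_ R x ρ₀) ρ₀ e)

module TruthValues {c ℓ : Level} (R : CommutativeRing c ℓ) where
  open CommutativeRing R hiding (zero)
  open BooleanAlgebra R
  open Renaming R using (Sat-env-irrelevant; emptyEnv)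
  open Equivalence using (to; from)

  TV-mono : ∀ {m n} (Θ : Formula m) (Θ′ : Formula n) {ρ ρ′ b b′} →
            TV R Θ ρ b → TV R Θ′ ρ′ b′ →
            (∀ a → Atom R a → Sat R a Θ ρ → Sat R a Θ′ ρ′) → _≤B_ R b b′
  TV-mono _ _ (_ , _ , least) (b′² , upper′ , _) atoms-transfer =
    least _ b′² (λ a (atom , sat) → upper′ a (atom , atoms-transfer a atom sat))

  TV-cong : ∀ {m n} {Θ : Formula m} {Θ′ : Formula n} {ρ ρ′ b} →
            (∀ a → Sat R a Θ ρ ⇔ Sat R a Θ′ ρ′) → TV R Θ ρ b → TV R Θ′ ρ′ b
  TV-cong same (b² , upper , least) =
    b² , (λ a (atom , sat) → upper a (atom , from (same a) sat))
       , (λ u u² bound → least u u² (λ a (atom , sat) → bound a (atom , to (same a) sat)))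

  TV-env-irrelevant : (θ : Formula 1) → ∀ {x b} {ρ₀ ρ₁ : Env R 0} →
                      TV R θ (_∷ₑ_ R x ρ₀) b → TV R θ (_∷ₑ_ R x ρ₁) b
  TV-env-irrelevant θ = TV-cong (λ a → Sat-env-irrelevant θ a)

  -- Every idempotent e lies below [[e = 1]]: each atom a below e has a·e = a·1.
  ≤B-[[x=1]] : ExcludedMiddle (c ⊔ ℓ) → AtomicB R → ∀ {e b} →
               Idem R e → TV R (isOne R) (_∷ₑ_ R e emptyEnv) b → _≤B_ R e b
  ≤B-[[x=1]] em atomic e² (b² , upper , _) = atoms-below⇒≤B em atomic e² b²
    (λ a atom a≤e → upper a (atom , lift (trans a≤e (sym (*-identityʳ a)))))

mainTheorem5 : ∀ {c ℓ : Level} → ExcludedMiddle (c ⊔ ℓ) →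
    (R : CommutativeRing c ℓ) →
    ¬ (CommutativeRing._≈_ R (CommutativeRing.1# R) (CommutativeRing.0# R)) →
    (φ : Formula 1) → (𝓕 : CommutativeRing.Carrier R → Set (c ⊔ ℓ)) →
    Axioms R φ 𝓕 → Sharp R φ 𝓕 →
    ∀ e → Idem R e →
      (𝓕 e → Σ (CommutativeRing.Carrier R) λ g → Σ (CommutativeRing.Carrier R) λ h →
               ∀ b → TV R (ψ♯ R φ) (pair R g h) b → _≤B_ R e b)
      × ((Σ (CommutativeRing.Carrier R) λ g → Σ (CommutativeRing.Carrier R) λ h →
               ∀ b → TV R (ψ♯ R φ) (pair R g h) b → _≤B_ R e b) → 𝓕 e)
mainTheorem5 em R _ φ 𝓕 A sharp e e² = witnesses-from-𝓕 , 𝓕-from-witnesses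
  where
  open Axioms A
  open CommutativeRing R using (Carrier)
  open BooleanAlgebra R
  open Renaming R
  open TruthValues R
  open Equivalence using (from)

  -- e ≤ [[e = 1]] ≤ [[ψ]].  Condition (♯) fixes its own empty environment for
  -- [[e = 1]]; satisfaction of  x = 1  never inspects it, so emptyEnv fits.
  witnesses-from-𝓕 : 𝓕 e → Σ Carrier λ g → Σ Carrier λ h →
                     ∀ b → TV R (ψ♯ R φ) (pair R g h) b → _≤B_ R e b
  witnesses-from-𝓕 e∈𝓕 with sharp e e∈𝓕
  ... | g , h , [[e=1]]≤[[ψ]] = g , h , λ b tvψ →
    let (b₁ , tv₁) = ax2 (isOne R) (_∷ₑ_ R e emptyEnv)
    in ≤B-trans (≤B-[[x=1]] em ax1 e² tv₁) ([[e=1]]≤[[ψ]] b₁ b tv₁ tvψ)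

  -- e ≤ [[ψ]] ≤ [[¬φ(h)]] ∈ 𝓕in, and 𝓕in is downward closed.
  𝓕-from-witnesses : (Σ Carrier λ g → Σ Carrier λ h →
                       ∀ b → TV R (ψ♯ R φ) (pair R g h) b → _≤B_ R e b) → 𝓕 e
  𝓕-from-witnesses (g , h , e≤[[ψ]])
    with ax2 (ψ♯ R φ) (pair R g h) | ax2 (~ φ) (_∷ₑ_ R h emptyEnv)
  ... | bψ , tvψ | b¬φh , tv¬φh =
    ideal-downward ax4-Tfin e² (ax5 h b¬φh (TV-env-irrelevant (~ φ) tv¬φh))
      (≤B-trans (e≤[[ψ]] bψ tvψ) (TV-mono (ψ♯ R φ) (~ φ) tvψ tv¬φh ψ⇒¬φh))
    where
    ψ⇒¬φh : ∀ a → Atom R a → Sat R a (ψ♯ R φ) (pair R g h) →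
            Sat R a (~ φ) (_∷ₑ_ R h emptyEnv)
    ψ⇒¬φh a _ (_ , _ , ¬φh) = ¬φh ∘ from (Sat-at φ (suc zero) (pair R g h) emptyEnv a)
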